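{- For a threshold graph $G$ and integer $d\ge0$, $\mathrm{degen}(G)=d$ if and only if $\mathrm{seq}(G)$ contains exactly $d$ ones.
   Context: The degeneracy of a graph $G$ is $\mathrm{degen}(G)=\max_{H}\min_{v\in V(H)}\deg_H(v)$, the maximum over nonempty induced subgraphs $H$ of $G$ of the minimum degree of $H$. A threshold graph on $n$ vertices is built from a single base vertex by adding $n-1$ vertices one at a time, each either isolated or dominating (adjacent to all existing vertices); its creation sequence $\mathrm{seq}(G)\in\{0,1\}^{n-1}$ records $1$ for a dominating and $0$ for an isolated addition. -}

module Defs where

open import Data.Bool using (Bool; true; false; if_then_else_)
open import Data.Nat using (ℕ; zero; suc; _≤_; _<ᵇ_)
open import Data.Fin using (Fin; zero; suc; toℕ)
open import Data.Fin.Subset using (Subset; _∈_; _∩_; ∣_∣; Nonempty)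
open import Data.Vec using (Vec; []; _∷_; lookup; tabulate)
open import Data.Product using (Σ; ∃; _×_)
open import Relation.Binary.PropositionalEquality using (_≡_)
open import Function.Definitions using (Injective)

record Graph (m : ℕ) : Set where
  field
    adj   : Fin m → Fin m → Bool
    sym   : ∀ u v → adj u v ≡ adj v u
    irrefl : ∀ v → adj v v ≡ false
open Graph public

N : ∀ {m} → Graph m → Fin m → Subset m
N G v = tabulate (adj G v)

degIn : ∀ {m} → Graph m → Subset m → Fin m → ℕ
degIn G H v = ∣ H ∩ N G v ∣

-- degen(G) = d, written out as "the max over nonempty induced subgraphs H
-- of the min degree of H equals d":
--  * some nonempty H has min degree ≥ d (the max is attained and ≥ d), and
--  * every nonempty H has a vertex of degree ≤ d (every min is ≤ d).
Degeneracy : ∀ {m} → Graph m → ℕ → Set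
Degeneracy {m} G d =
  (Σ (Subset m) λ H → Nonempty H × (∀ v → v ∈ H → d ≤ degIn G H v))
  × (∀ (H : Subset m) → Nonempty H → ∃ λ v → v ∈ H × degIn G H v ≤ d)

-- Threshold graph built from creation sequence s ∈ {0,1}^n on vertices
-- Fin (suc n): vertex 0 is the base vertex, vertex (suc k) is the k-th added
-- vertex, dominating iff lookup s k = true.  Two vertices are adjacent iff
-- the later-added one is dominating.
thresholdAdj : ∀ {n} → Vec Bool n → Fin (suc n) → Fin (suc n) → Bool
thresholdAdj s zero    zero    = false
thresholdAdj s zero    (suc j) = lookup s j
thresholdAdj s (suc i) zero    = lookup s i
thresholdAdj s (suc i) (suc j) =
  if toℕ i <ᵇ toℕ j then lookup s j
  else (if toℕ j <ᵇ toℕ i then lookup s i else false)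

-- s is a creation sequence of G: G is isomorphic to the threshold graph
-- built from s (σ is an injective, hence bijective, relabelling).
HasCreationSequence : ∀ {n} → Graph (suc n) → Vec Bool n → Set
HasCreationSequence {n} G s =
  Σ (Fin (suc n) → Fin (suc n)) λ σ →
    Injective _≡_ _≡_ σ × (∀ i j → adj G (σ i) (σ j) ≡ thresholdAdj s i j)

ones : ∀ {n} → Vec Bool n → ℕ
ones []          = 0
ones (true ∷ s)  = suc (ones s)
ones (false ∷ s) = ones s

-- Relabelling a graph along a permutation preserves all induced degrees, so it
-- suffices to treat the threshold graph built from s itself.  Its base vertex
-- together with the dominating vertices forms a clique of size 1 + #ones, in
-- which every vertex has degree #ones.  Conversely, any nonempty H contains a
-- vertex of degree at most #ones: a non-dominating vertex of H, whose
-- neighbours are all dominating, or, if there is none, any vertex of H, since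
-- then H lies inside the #ones dominating vertices.
module Submission where

open import Defs hiding (sym)
open import Data.Bool using (Bool; true; false; _∧_; if_then_else_)
open import Data.Nat using (ℕ; suc; _≤_; _<ᵇ_)
open import Data.Nat.Properties
  using ( +-0-commutativeMonoid; <ᵇ-reflects-<; <-asym; <-irrefl; ≤-antisym; ≮⇒≥; ≤-trans
        ; 1+n≰n; suc-injective; module ≤-Reasoning )
open import Data.Fin using (Fin; zero; suc; toℕ; punchOut)
open import Data.Fin.Properties using (toℕ-injective; injective⇒≤; punchOut-injective; any?; _≟_)
open import Data.Fin.Permutation
  using (Permutation′; permutation; _⟨$⟩ʳ_; _⟨$⟩ˡ_; inverseˡ; inverseʳ; flip)
open import Data.Fin.Subset
  using (Subset; inside; outside; _∈_; _∉_; _⊆_; _∩_; _─_; _-_; ∣_∣; Nonempty)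
open import Data.Fin.Subset.Properties
  using (p─⊥≡p; p⊆q⇒∣p∣≤∣q∣; p─q⊆p; x∈p∩q⁺; x∈p∩q⁻; x∉⁅y⁆⇒x≢y; _∈?_)
open import Data.Product using (∃; _×_; _,_; proj₁; proj₂; uncurry)
open import Data.Sum using (_⊎_; inj₁; inj₂; [_,_]′)
open import Data.Vec using (Vec; []; _∷_; lookup; tabulate; here; there)
open import Data.Vec.Properties
  using ([]=⇒lookup; lookup⇒[]=; lookup∘tabulate; tabulate-cong; lookup-zipWith)
open import Data.Vec.Relation.Binary.Pointwise.Extensional using (ext; Pointwise-≡⇒≡)
open import Function using (_∘_; id)
open import Function.Definitions using (Injective)
open import Relation.Binary.PropositionalEquality
open import Relation.Nullary using (yes; no; ¬?; contradiction)
open import Relation.Nullary.Decidable using (_×-dec_; decidable-stable)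
open import Relation.Nullary.Reflects using (ofʸ; ofⁿ)
open import Algebra.Properties.CommutativeMonoid.Sum +-0-commutativeMonoid
  using (sum; sum-cong-≗; sum-permute)

private
  variable
    m n : ℕ

x∈p─q⇒x∉q : {p q : Subset n} {x : Fin n} → x ∈ p ─ q → x ∉ q
x∈p─q⇒x∉q {p = _ ∷ _} ()            here
x∈p─q⇒x∉q {p = _ ∷ _} (there x∈p─q) (there x∈q) = x∈p─q⇒x∉q x∈p─q x∈q

x∈p⇒∣p∣≡1+∣p-x∣ : {p : Subset n} {x : Fin n} → x ∈ p → ∣ p ∣ ≡ suc ∣ p - x ∣
x∈p⇒∣p∣≡1+∣p-x∣ {p = inside  ∷ p} here        = cong (λ q → suc ∣ q ∣) (sym (p─⊥≡p p))
x∈p⇒∣p∣≡1+∣p-x∣ {p = inside  ∷ p} (there x∈p) = cong suc (x∈p⇒∣p∣≡1+∣p-x∣ x∈p)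
x∈p⇒∣p∣≡1+∣p-x∣ {p = outside ∷ p} (there x∈p) = x∈p⇒∣p∣≡1+∣p-x∣ x∈p

preimage : (Fin m → Fin n) → Subset n → Subset m
preimage f p = tabulate (lookup p ∘ f)

∈-preimage⁺ : {f : Fin m → Fin n} {p : Subset n} {x : Fin m} → f x ∈ p → x ∈ preimage f p
∈-preimage⁺ {f = f} {p} {x} fx∈p =
  lookup⇒[]= x (preimage f p) (trans (lookup∘tabulate (lookup p ∘ f) x) ([]=⇒lookup fx∈p))

∈-preimage⁻ : {f : Fin m → Fin n} {p : Subset n} {x : Fin m} → x ∈ preimage f p → f x ∈ p
∈-preimage⁻ {f = f} {p} {x} x∈ =
  lookup⇒[]= (f x) p (trans (sym (lookup∘tabulate (lookup p ∘ f) x)) ([]=⇒lookup x∈))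

preimage-∩ : (f : Fin m → Fin n) (p q : Subset n) →
  preimage f (p ∩ q) ≡ preimage f p ∩ preimage f q
preimage-∩ f p q = Pointwise-≡⇒≡ (ext λ i → begin
  lookup (preimage f (p ∩ q)) i                      ≡⟨ lookup∘tabulate _ i ⟩
  lookup (p ∩ q) (f i)                               ≡⟨ lookup-zipWith _ (f i) p q ⟩
  lookup p (f i) ∧ lookup q (f i)                    ≡⟨ cong₂ _∧_ (lookup∘tabulate _ i) (lookup∘tabulate _ i) ⟨
  lookup (preimage f p) i ∧ lookup (preimage f q) i  ≡⟨ lookup-zipWith _ i (preimage f p) (preimage f q) ⟨
  lookup (preimage f p ∩ preimage f q) i             ∎)
  where open ≡-Reasoning

∣p∣≡∑ : (p : Subset n) → ∣ p ∣ ≡ sum (λ i → if lookup p i then 1 else 0)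
∣p∣≡∑ []            = refl
∣p∣≡∑ (inside  ∷ p) = cong suc (∣p∣≡∑ p)
∣p∣≡∑ (outside ∷ p) = ∣p∣≡∑ p

∣preimage∣≡∣p∣ : (π : Permutation′ n) (p : Subset n) → ∣ preimage (π ⟨$⟩ʳ_) p ∣ ≡ ∣ p ∣
∣preimage∣≡∣p∣ π p = begin
  ∣ preimage (π ⟨$⟩ʳ_) p ∣                           ≡⟨ ∣p∣≡∑ (preimage (π ⟨$⟩ʳ_) p) ⟩
  sum (λ i → if lookup (preimage (π ⟨$⟩ʳ_) p) i then 1 else 0)
    ≡⟨ sum-cong-≗ (λ i → cong (λ b → if b then 1 else 0) (lookup∘tabulate (lookup p ∘ (π ⟨$⟩ʳ_)) i)) ⟩
  sum (λ i → if lookup p (π ⟨$⟩ʳ i) then 1 else 0)   ≡⟨ sum-permute _ π ⟨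
  sum (λ i → if lookup p i then 1 else 0)            ≡⟨ ∣p∣≡∑ p ⟨
  ∣ p ∣                                              ∎
  where open ≡-Reasoning

injective⇒surjective : {f : Fin n → Fin n} → Injective _≡_ _≡_ f → ∀ y → ∃ λ x → f x ≡ y
injective⇒surjective {suc n} {f} f-injective y with any? (λ x → f x ≟ y)
... | yes hit = hit
... | no miss = contradiction (injective⇒≤ squeeze-injective) 1+n≰n
  where
  -- if y is missed, f factors injectively through Fin n
  missed : ∀ x → y ≢ f x
  missed x y≡fx = miss (x , sym y≡fx)

  squeeze : Fin (suc n) → Fin n
  squeeze x = punchOut (missed x)

  squeeze-injective : Injective _≡_ _≡_ squeeze
  squeeze-injective {x} {x′} = f-injective ∘ punchOut-injective (missed x) (missed x′)

injective⇒permutation : {f : Fin n → Fin n} → Injective _≡_ _≡_ f → Permutation′ n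
injective⇒permutation {f = f} f-injective =
  permutation f (proj₁ ∘ surjection) (proj₂ ∘ surjection)
    (λ x → f-injective (proj₂ (surjection (f x))))
  where
  surjection : ∀ y → ∃ λ x → f x ≡ y
  surjection = injective⇒surjective f-injective

∈N⇒adj : (G : Graph n) {u v : Fin n} → u ∈ N G v → adj G v u ≡ true
∈N⇒adj G {u} {v} u∈Nv = trans (sym (lookup∘tabulate (adj G v) u)) ([]=⇒lookup u∈Nv)

adj⇒∈N : (G : Graph n) {u v : Fin n} → adj G v u ≡ true → u ∈ N G v
adj⇒∈N G {u} {v} uv = lookup⇒[]= u (N G v) (trans (lookup∘tabulate (adj G v) u) uv)

Degeneracy-unique : (G : Graph n) {d e : ℕ} → Degeneracy G d → Degeneracy G e → d ≡ e
Degeneracy-unique G Dd De = ≤-antisym (witness≤bound Dd De) (witness≤bound De Dd)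
  where
  witness≤bound : ∀ {d e} → Degeneracy G d → Degeneracy G e → d ≤ e
  witness≤bound ((H , H≢∅ , d≤deg) , _) (_ , lowVertex) with lowVertex H H≢∅
  ... | v , v∈H , deg≤e = ≤-trans (d≤deg v v∈H) deg≤e

record Relabelling (π : Permutation′ n) (G G′ : Graph n) : Set where
  constructor relabelling
  field
    relabels : ∀ i j → adj G (π ⟨$⟩ʳ i) (π ⟨$⟩ʳ j) ≡ adj G′ i j
open Relabelling

Relabelling-flip : {π : Permutation′ n} {G G′ : Graph n} →
  Relabelling π G G′ → Relabelling (flip π) G′ G
Relabelling-flip {π = π} {G} {G′} rel = relabelling λ u w → begin
  adj G′ (π ⟨$⟩ˡ u) (π ⟨$⟩ˡ w)                  ≡⟨ relabels rel (π ⟨$⟩ˡ u) (π ⟨$⟩ˡ w) ⟨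
  adj G (π ⟨$⟩ʳ (π ⟨$⟩ˡ u)) (π ⟨$⟩ʳ (π ⟨$⟩ˡ w))  ≡⟨ cong₂ (adj G) (inverseʳ π) (inverseʳ π) ⟩
  adj G u w                                     ∎
  where open ≡-Reasoning

degIn-relabel : {π : Permutation′ n} {G G′ : Graph n} → Relabelling π G G′ →
  ∀ H i → degIn G H (π ⟨$⟩ʳ i) ≡ degIn G′ (preimage (π ⟨$⟩ʳ_) H) i
degIn-relabel {n = n} {π = π} {G} {G′} rel H i = begin
  ∣ H ∩ N G (π ⟨$⟩ʳ i) ∣                          ≡⟨ ∣preimage∣≡∣p∣ π (H ∩ N G (π ⟨$⟩ʳ i)) ⟨
  ∣ π⁻[ H ∩ N G (π ⟨$⟩ʳ i) ] ∣                    ≡⟨ cong ∣_∣ (preimage-∩ (π ⟨$⟩ʳ_) H _) ⟩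
  ∣ π⁻[ H ] ∩ π⁻[ N G (π ⟨$⟩ʳ i) ] ∣              ≡⟨ cong (λ q → ∣ π⁻[ H ] ∩ q ∣) neighbourhood ⟩
  ∣ π⁻[ H ] ∩ N G′ i ∣                            ∎
  where
  open ≡-Reasoning
  π⁻[_] : Subset n → Subset n
  π⁻[_] = preimage (π ⟨$⟩ʳ_)

  neighbourhood : π⁻[ N G (π ⟨$⟩ʳ i) ] ≡ N G′ i
  neighbourhood = tabulate-cong λ j →
    trans (lookup∘tabulate (adj G (π ⟨$⟩ʳ i)) (π ⟨$⟩ʳ j)) (relabels rel i j)

Degeneracy-relabel : {π : Permutation′ n} {G G′ : Graph n} {d : ℕ} →
  Relabelling π G G′ → Degeneracy G′ d → Degeneracy G d
Degeneracy-relabel {π = π} {G} {G′} {d} rel ((H′ , (x , x∈H′) , d≤deg) , lowVertex) =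
  (preimage (π ⟨$⟩ˡ_) H′ , H≢∅ , d≤degH) , lowVertexG
  where
  H≢∅ : Nonempty (preimage (π ⟨$⟩ˡ_) H′)
  H≢∅ = π ⟨$⟩ʳ x , ∈-preimage⁺ (subst (_∈ H′) (sym (inverseˡ π)) x∈H′)

  d≤degH : ∀ v → v ∈ preimage (π ⟨$⟩ˡ_) H′ → d ≤ degIn G (preimage (π ⟨$⟩ˡ_) H′) v
  d≤degH v v∈H =
    subst (d ≤_) (degIn-relabel (Relabelling-flip rel) H′ v) (d≤deg (π ⟨$⟩ˡ v) (∈-preimage⁻ v∈H))

  lowVertexG : ∀ H → Nonempty H → ∃ λ v → v ∈ H × degIn G H v ≤ d
  lowVertexG H (y , y∈H) with lowVertex (preimage (π ⟨$⟩ʳ_) H)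
                                (π ⟨$⟩ˡ y , ∈-preimage⁺ (subst (_∈ H) (sym (inverseʳ π)) y∈H))
  ... | i , i∈ , deg≤d = π ⟨$⟩ʳ i , ∈-preimage⁻ i∈ , subst (_≤ d) (sym (degIn-relabel rel H i)) deg≤d

thresholdAdj-irrefl : (s : Vec Bool n) (i : Fin (suc n)) → thresholdAdj s i i ≡ false
thresholdAdj-irrefl s zero = refl
thresholdAdj-irrefl s (suc i) with toℕ i <ᵇ toℕ i | <ᵇ-reflects-< (toℕ i) (toℕ i)
... | true  | ofʸ i<i = contradiction i<i (<-irrefl refl)
... | false | _       = refl

thresholdAdj-sym : (s : Vec Bool n) (i j : Fin (suc n)) → thresholdAdj s i j ≡ thresholdAdj s j i
thresholdAdj-sym s zero    zero    = refl
thresholdAdj-sym s zero    (suc j) = refl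
thresholdAdj-sym s (suc i) zero    = refl
thresholdAdj-sym s (suc i) (suc j)
  with toℕ i <ᵇ toℕ j | <ᵇ-reflects-< (toℕ i) (toℕ j) | toℕ j <ᵇ toℕ i | <ᵇ-reflects-< (toℕ j) (toℕ i)
... | true  | ofʸ i<j | true  | ofʸ j<i = contradiction j<i (<-asym i<j)
... | true  | _       | false | _       = refl
... | false | _       | true  | _       = refl
... | false | _       | false | _       = refl

thresholdGraph : Vec Bool n → Graph (suc n)
thresholdGraph s = record
  { adj    = thresholdAdj s
  ; sym    = thresholdAdj-sym s
  ; irrefl = thresholdAdj-irrefl s
  }

dominating : Vec Bool n → Subset (suc n)
dominating s = outside ∷ s

clique : Vec Bool n → Subset (suc n)
clique s = inside ∷ s

thresholdAdj⇒dominating : (s : Vec Bool n) (i j : Fin (suc n)) →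
  thresholdAdj s i j ≡ true → i ∈ dominating s ⊎ j ∈ dominating s
thresholdAdj⇒dominating s zero    (suc j) sⱼ = inj₂ (there (lookup⇒[]= j s sⱼ))
thresholdAdj⇒dominating s (suc i) zero    sᵢ = inj₁ (there (lookup⇒[]= i s sᵢ))
thresholdAdj⇒dominating s (suc i) (suc j) ij with toℕ i <ᵇ toℕ j | toℕ j <ᵇ toℕ i
... | true  | _    = inj₂ (there (lookup⇒[]= j s ij))
... | false | true = inj₁ (there (lookup⇒[]= i s ij))

clique⇒thresholdAdj : (s : Vec Bool n) (i j : Fin (suc n)) →
  i ∈ clique s → j ∈ clique s → i ≢ j → thresholdAdj s i j ≡ true
clique⇒thresholdAdj s zero    zero    _           _           i≢j = contradiction refl i≢j
clique⇒thresholdAdj s zero    (suc j) _           (there j∈s) _   = []=⇒lookup j∈s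
clique⇒thresholdAdj s (suc i) zero    (there i∈s) _           _   = []=⇒lookup i∈s
clique⇒thresholdAdj s (suc i) (suc j) (there i∈s) (there j∈s) i≢j
  with toℕ i <ᵇ toℕ j | <ᵇ-reflects-< (toℕ i) (toℕ j) | toℕ j <ᵇ toℕ i | <ᵇ-reflects-< (toℕ j) (toℕ i)
... | true  | _       | _     | _       = []=⇒lookup j∈s
... | false | _       | true  | _       = []=⇒lookup i∈s
... | false | ofⁿ i≮j | false | ofⁿ j≮i =
  contradiction (cong suc (toℕ-injective (≤-antisym (≮⇒≥ j≮i) (≮⇒≥ i≮j)))) i≢j

clique-degree : (s : Vec Bool n) {v : Fin (suc n)} →
  v ∈ clique s → ∣ s ∣ ≤ degIn (thresholdGraph s) (clique s) v
clique-degree s {v} v∈C = begin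
  ∣ s ∣                                    ≡⟨ suc-injective (x∈p⇒∣p∣≡1+∣p-x∣ v∈C) ⟩
  ∣ clique s - v ∣                         ≤⟨ p⊆q⇒∣p∣≤∣q∣ C-v⊆C∩Nv ⟩
  ∣ clique s ∩ N (thresholdGraph s) v ∣    ∎
  where
  open ≤-Reasoning
  C-v⊆C∩Nv : clique s - v ⊆ clique s ∩ N (thresholdGraph s) v
  C-v⊆C∩Nv {u} u∈C-v =
    x∈p∩q⁺ (u∈C , adj⇒∈N (thresholdGraph s) {v = v} (clique⇒thresholdAdj s v u v∈C u∈C v≢u))
    where
    u∈C : u ∈ clique s
    u∈C = p─q⊆p (clique s) _ u∈C-v
    v≢u : v ≢ u
    v≢u = x∉⁅y⁆⇒x≢y (x∈p─q⇒x∉q u∈C-v) ∘ sym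

dominating-neighbours⇒degIn≤∣s∣ : (s : Vec Bool n) (H : Subset (suc n)) (v : Fin (suc n)) →
  (∀ {u} → u ∈ H → u ∈ N (thresholdGraph s) v → u ∈ dominating s) →
  degIn (thresholdGraph s) H v ≤ ∣ s ∣
dominating-neighbours⇒degIn≤∣s∣ s H v H∩Nv⊆D =
  p⊆q⇒∣p∣≤∣q∣ (λ u∈H∩Nv → uncurry H∩Nv⊆D (x∈p∩q⁻ H _ u∈H∩Nv))

low-degree-vertex : (s : Vec Bool n) (H : Subset (suc n)) → Nonempty H →
  ∃ λ v → v ∈ H × degIn (thresholdGraph s) H v ≤ ∣ s ∣
low-degree-vertex s H (x , x∈H) with any? (λ v → v ∈? H ×-dec ¬? (v ∈? dominating s))
... | yes (v , v∈H , v∉D) = v , v∈H , dominating-neighbours⇒degIn≤∣s∣ s H v λ _ u∈Nv →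
  [ (λ v∈D → contradiction v∈D v∉D) , id ]′
    (thresholdAdj⇒dominating s v _ (∈N⇒adj (thresholdGraph s) {v = v} u∈Nv))
... | no H⊈D = x , x∈H , dominating-neighbours⇒degIn≤∣s∣ s H x λ {u} u∈H _ →
  decidable-stable (u ∈? dominating s) (λ u∉D → H⊈D (u , u∈H , u∉D))

threshold-degeneracy : (s : Vec Bool n) → Degeneracy (thresholdGraph s) ∣ s ∣
threshold-degeneracy s = (clique s , (zero , here) , λ _ → clique-degree s) , low-degree-vertex s

∣s∣≡ones : (s : Vec Bool n) → ∣ s ∣ ≡ ones s
∣s∣≡ones []          = refl
∣s∣≡ones (true  ∷ s) = cong suc (∣s∣≡ones s)
∣s∣≡ones (false ∷ s) = ∣s∣≡ones s

mainTheorem10 : ∀ {n} (G : Graph (suc n)) (s : Vec Bool n) →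
    HasCreationSequence G s → (d : ℕ) →
    (Degeneracy G d → ones s ≡ d) × (ones s ≡ d → Degeneracy G d)
mainTheorem10 G s (σ , σ-injective , σ-relabels) _ =
  Degeneracy-unique G degen-ones , λ ones≡d → subst (Degeneracy G) ones≡d degen-ones
  where
  σ-relabelling : Relabelling (injective⇒permutation σ-injective) G (thresholdGraph s)
  σ-relabelling = relabelling σ-relabels

  degen-ones : Degeneracy G (ones s)
  degen-ones = subst (Degeneracy G) (∣s∣≡ones s)
    (Degeneracy-relabel σ-relabelling (threshold-degeneracy s))
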